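{- For any poset $P$ on $\{1,2,\ldots,n\}$ and field $k$, the following are equivalent: (i) any (equivalently, all) of the presentations $R_P\cong S/I_P$, $\mathfrak{gr}(R_P)\cong S/I^{\mathfrak{gr}}_P$, and $S/I^{\mathrm{init}}_P$ is a complete intersection presentation; (ii) $|\Pi(P)|=|\mathcal{B}(P)|=|\mathcal{J}_{\mathrm{conn}}(P)|-|P|$; (iii) the map $\pi:\Pi(P)\to\mathcal{B}(P)$, $\{J_1,J_2\}\mapsto J_1\cup J_2$, is a bijection; (iv) every nonempty connected order ideal of $P$ is either principal or nearly principal.
   Context: An order ideal is connected if its induced Hasse diagram is connected; $\mathcal{J}_{\mathrm{conn}}(P)$ is the set of nonempty connected order ideals; $\Pi(P)$ is the set of unordered pairs $\{J_1,J_2\}$ of elements of $\mathcal{J}_{\mathrm{conn}}(P)$ that are neither disjoint nor nested; $\mathcal{B}(P)$ is the set of connected nonprincipal order ideals (the map $\pi$ is a well-defined surjection). A connected nonprincipal ideal $J$ is nearly principal if there is exactly one pair $\{J_1,J_2\}\in\Pi(P)$ with $J_1\cup J_2=J$. Weak $P$-partitions are maps $f:\{1,\ldots,n\}\to\mathbb{N}$ with $f(i)\ge f(j)$ whenever $i<_P j$; $R_P\subseteq k[x_1,\ldots,x_n]$ is the $k$-span of $\mathbf{x}^f$, $f$ weak; $\mathfrak{m}$ its ideal spanned by $\mathbf{x}^f$, $f\ne0$; $\mathfrak{gr}(R_P)=\bigoplus\mathfrak{m}^i/\mathfrak{m}^{i+1}$. $S=k[U_J]_{J\in\mathcal{J}_{\mathrm{conn}}(P)}$;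 $I_P$ (resp. $I^{\mathfrak{gr}}_P$) is the kernel of $S\to R_P$ (resp. $S\to\mathfrak{gr}(R_P)$) sending $U_J$ to $\prod_{j\in J}x_j$ (resp. its class in $\mathfrak{m}/\mathfrak{m}^2$); $I^{\mathrm{init}}_P$ is generated by $U_{J_1}U_{J_2}$ for $\{J_1,J_2\}\in\Pi(P)$. Each of these three ideals is minimally generated by $|\Pi(P)|$ elements, and each quotient has Krull dimension $n$; a presentation is a complete intersection presentation if $n+|\Pi(P)|=|\mathcal{J}_{\mathrm{conn}}(P)|$ (equivalently, the minimal generators form an $S$-regular sequence). -}

module Defs where

open import Level using (0ℓ)
open import Data.Nat using (ℕ; zero; suc)
open import Data.Bool using (Bool; true; false; _∨_; _∧_)
import Data.Bool as Bool
open import Data.Fin using (Fin)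
import Data.Fin as Fin
open import Data.Fin.Properties using (any?; all?)
open import Data.Fin.Subset using (Subset; _∈_; _∉_; _⊆_; _∪_; _∩_; ⁅_⁆; Nonempty)
open import Data.Fin.Subset.Properties using (_∈?_; _⊆?_; nonempty?)
open import Data.Vec using (Vec; []; _∷_; tabulate)
open import Data.Vec.Properties using (≡-dec)
open import Data.List using (List; []; _∷_; _++_; map; length; filter; concatMap)
open import Data.Product using (_×_; _,_; ∃; Σ)
open import Data.Sum using (_⊎_)
open import Relation.Nullary using (¬_; Dec; yes; no; ¬?; _×-dec_; _⊎-dec_; _→-dec_)
open import Relation.Nullary.Decidable using (⌊_⌋)
open import Relation.Binary using (Rel; IsDecPartialOrder; DecidableEquality)
open import Relation.Binary.PropositionalEquality using (_≡_; _≢_)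

record FinPoset (n : ℕ) : Set₁ where
  field
    _≤P_ : Rel (Fin n) 0ℓ
    isDecPartialOrder : IsDecPartialOrder _≡_ _≤P_

  open IsDecPartialOrder isDecPartialOrder public using () renaming (_≤?_ to _≤P?_)

allSubsets : (n : ℕ) → List (Subset n)
allSubsets zero    = [] ∷ []
allSubsets (suc n) = map (true ∷_) (allSubsets n) ++ map (false ∷_) (allSubsets n)

_≟S_ : ∀ {n} → DecidableEquality (Subset n)
_≟S_ = ≡-dec Bool._≟_

unorderedPairs : ∀ {A : Set} → List A → List (A × A)
unorderedPairs []       = []
unorderedPairs (x ∷ xs) = map (x ,_) xs ++ unorderedPairs xs

module _ {n : ℕ} (P : FinPoset n) where
  open FinPoset P

  _<P_ : Rel (Fin n) 0ℓ
  x <P y = x ≤P y × x ≢ y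

  _<P?_ : ∀ x y → Dec (x <P y)
  x <P? y = (x ≤P? y) ×-dec ¬? (x Fin.≟ y)

  _⋖_ : Rel (Fin n) 0ℓ
  x ⋖ y = x <P y × ¬ (∃ λ z → x <P z × z <P y)

  _⋖?_ : ∀ x y → Dec (x ⋖ y)
  x ⋖? y = (x <P? y) ×-dec ¬? (any? (λ z → (x <P? z) ×-dec (z <P? y)))

  HasseEdge : Rel (Fin n) 0ℓ
  HasseEdge x y = x ⋖ y ⊎ y ⋖ x

  HasseEdge? : ∀ x y → Dec (HasseEdge x y)
  HasseEdge? x y = (x ⋖? y) ⊎-dec (y ⋖? x)

  IsOrderIdeal : Subset n → Set
  IsOrderIdeal J = ∀ x y → x ∈ J → y ≤P x → y ∈ J

  IsOrderIdeal? : ∀ J → Dec (IsOrderIdeal J)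
  IsOrderIdeal? J = all? λ x → all? λ y →
    (x ∈? J) →-dec ((y ≤P? x) →-dec (y ∈? J))

  reach : Subset n → ℕ → Fin n → Subset n
  reach J zero    x = ⁅ x ⁆
  reach J (suc k) x = tabulate λ y →
    ⌊ y ∈? R ⌋ ∨ (⌊ y ∈? J ⌋ ∧ ⌊ any? (λ z → (z ∈? R) ×-dec HasseEdge? z y) ⌋)
    where R = reach J k x

  -- the induced Hasse diagram on J is connected: any two vertices of J are
  -- joined by a walk inside J (walks of length ≤ n suffice, as |J| ≤ n)
  IsConnectedSet : Subset n → Set
  IsConnectedSet J = ∀ x y → x ∈ J → y ∈ J → y ∈ reach J n x

  IsConnectedSet? : ∀ J → Dec (IsConnectedSet J)
  IsConnectedSet? J = all? λ x → all? λ y →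
    (x ∈? J) →-dec ((y ∈? J) →-dec (y ∈? reach J n x))

  IsConnIdeal : Subset n → Set
  IsConnIdeal J = Nonempty J × IsOrderIdeal J × IsConnectedSet J

  IsConnIdeal? : ∀ J → Dec (IsConnIdeal J)
  IsConnIdeal? J = nonempty? J ×-dec (IsOrderIdeal? J ×-dec IsConnectedSet? J)

  Jconn : List (Subset n)
  Jconn = filter IsConnIdeal? (allSubsets n)

  ↓_ : Fin n → Subset n
  ↓ x = tabulate λ y → ⌊ y ≤P? x ⌋

  IsPrincipal : Subset n → Set
  IsPrincipal J = ∃ λ x → J ≡ ↓ x

  IsPrincipal? : ∀ J → Dec (IsPrincipal J)
  IsPrincipal? J = any? λ x → J ≟S (↓ x)

  IsB : Subset n → Set
  IsB J = IsConnIdeal J × ¬ IsPrincipal J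

  IsB? : ∀ J → Dec (IsB J)
  IsB? J = IsConnIdeal? J ×-dec ¬? (IsPrincipal? J)

  Bset : List (Subset n)
  Bset = filter IsB? (allSubsets n)

  Crossing : Subset n → Subset n → Set
  Crossing J₁ J₂ = Nonempty (J₁ ∩ J₂) × ¬ (J₁ ⊆ J₂) × ¬ (J₂ ⊆ J₁)

  Crossing? : ∀ J₁ J₂ → Dec (Crossing J₁ J₂)
  Crossing? J₁ J₂ = nonempty? (J₁ ∩ J₂) ×-dec (¬? (J₁ ⊆? J₂) ×-dec ¬? (J₂ ⊆? J₁))

  InΠ : Subset n → Subset n → Set
  InΠ J₁ J₂ = IsConnIdeal J₁ × IsConnIdeal J₂ × Crossing J₁ J₂

  -- Π(P) as a list of unordered pairs (each unordered pair listed once)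
  Πlist : List (Subset n × Subset n)
  Πlist = filter (λ p → Crossing? (Data.Product.proj₁ p) (Data.Product.proj₂ p))
                 (unorderedPairs Jconn)

  IsNearlyPrincipal : Subset n → Set
  IsNearlyPrincipal J =
    IsB J × length (filter (λ p → (Data.Product.proj₁ p ∪ Data.Product.proj₂ p) ≟S J) Πlist) ≡ 1

  SamePair : Subset n × Subset n → Subset n × Subset n → Set
  SamePair (a , b) (c , d) = (a ≡ c × b ≡ d) ⊎ (a ≡ d × b ≡ c)

  -- (i) complete intersection presentation: n + |Π(P)| = |𝒥_conn(P)|
  CondI : Set
  CondI = n Data.Nat.+ length Πlist ≡ length Jconn

  CondII : Set
  CondII = length Πlist ≡ length Bset × length Bset ≡ length Jconn Data.Nat.∸ n

  CondIII : Set
  CondIII =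
    (∀ J₁ J₂ → InΠ J₁ J₂ → IsB (J₁ ∪ J₂))
    × (∀ J₁ J₂ J₁′ J₂′ → InΠ J₁ J₂ → InΠ J₁′ J₂′ →
         J₁ ∪ J₂ ≡ J₁′ ∪ J₂′ → SamePair (J₁ , J₂) (J₁′ , J₂′))
    × (∀ J → IsB J → ∃ λ J₁ → ∃ λ J₂ → InΠ J₁ J₂ × J₁ ∪ J₂ ≡ J)

  CondIV : Set
  CondIV = ∀ J → IsConnIdeal J → IsPrincipal J ⊎ IsNearlyPrincipal J

module Submission where

-- Write Π for the crossing pairs of nonempty connected ideals of P, 𝓑 for the
-- connected nonprincipal ideals and π{J₁,J₂} = J₁ ∪ J₂.  Three facts carry
-- the proof of Proposition 10.2:
--   (a) π lands in 𝓑: two meeting connected ideals have a connected union,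
--       which is not principal as neither part contains the other;
--   (b) π is onto 𝓑: inside J ∈ 𝓑 grow ↓x by one principal ideal ↓m meeting
--       the current ideal at a time; the last step writes J as π of a pair;
--   (c) the connected ideals are the n principal ones and 𝓑: |𝒥_conn| = n + |𝓑|.
-- Counting Π along the fibres of π gives |Π| = Σ_{J ∈ 𝓑} |π⁻¹ J| with all
-- fibres inhabited, so |Π| = |𝓑| iff all fibres are singletons.  By (c) this
-- is (i) and (ii); it is (iii) by (a) and (b), and (iv) by definition.

open import Defs
open import Level using (0ℓ)
open import Data.Nat using (ℕ; zero; suc; _+_; _∸_; _≤_; _<_; z≤n; s≤s)
open import Data.Nat.Properties
  using (≤-trans; ≤-antisym; ≤-reflexive; <⇒≱; +-mono-≤; +-monoʳ-≤;
         +-cancelʳ-≤; +-cancelˡ-≡; +-suc; m∸n+n≡m; m+n∸m≡n;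
         m≤n⇒m≤1+n; n≤1+n; +-commutativeSemigroup)
open import Algebra.Properties.CommutativeSemigroup +-commutativeSemigroup
  using (interchange)
open import Data.Nat.ListAction using (sum)
open import Data.Bool using (Bool; true; false; _∨_; _∧_)
open import Data.Empty using (⊥; ⊥-elim)
open import Data.Fin using (Fin)
import Data.Fin as Fin
open import Data.Fin.Induction using (po-wellFounded; po-noetherian)
open import Data.Fin.Properties using (any?)
open import Data.Fin.Subset using (Subset; _∈_; _∉_; _⊆_; _⊂_; _⊃_; _∪_; _∩_; Nonempty; ∣_∣)
open import Data.Fin.Subset.Induction using (⊃-wellFounded)
open import Data.Fin.Subset.Properties
  using (_∈?_; nonempty?; ∣p∣≤n; ∣⁅x⁆∣≡1; p⊂q⇒∣p∣<∣q∣; ⊆-antisym; x∈⁅x⁆; x∈⁅y⁆⇒x≡y;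
         p⊆p∪q; q⊆p∪q; x∈p∪q⁻; x∈p∩q⁺; x∈p∩q⁻; ∪-comm)
open import Data.Vec using (tabulate; []; _∷_)
open import Data.Vec.Properties using (lookup∘tabulate; lookup⇒[]=; []=⇒lookup)
open import Data.List using (List; []; _∷_; [_]; map; length; filter; allFin)
open import Data.List.Properties
  using (filter-accept; filter-reject; filter-none; filter-some; length-map; length-tabulate)
open import Data.List.Membership.Propositional using (lose) renaming (_∈_ to _∈ₗ_; _∉_ to _∉ₗ_)
open import Data.List.Membership.Propositional.Properties
  using (∈-map⁺; ∈-map⁻; ∈-++⁺ˡ; ∈-++⁺ʳ; ∈-++⁻; ∈-filter⁺; ∈-filter⁻; ∈-allFin)
open import Data.List.Relation.Unary.Any using (here; there)
import Data.List.Relation.Unary.All as All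
open All using ([]; _∷_)
open import Data.List.Relation.Unary.AllPairs using ([]; _∷_)
open import Data.List.Relation.Unary.Unique.Propositional using (Unique)
import Data.List.Relation.Unary.Unique.Propositional.Properties as Unique
open import Data.Product using (_×_; _,_; ∃; proj₁; proj₂)
open import Data.Sum using (_⊎_; inj₁; inj₂)
open import Function using (_∘_; flip)
open import Function.Bundles using (_⇔_; mk⇔; Equivalence)
open import Function.Properties.Equivalence using () renaming (refl to ⇔-refl; trans to ⇔-trans)
open import Induction.WellFounded using (WellFounded; Acc; acc)
open import Relation.Binary using (IsDecPartialOrder; DecidableEquality)
open import Relation.Binary.PropositionalEquality
  using (_≡_; _≢_; refl; sym; trans; cong; cong₂; subst; module ≡-Reasoning)
open import Relation.Nullary using (¬_; Dec; yes; no; ¬?; _×-dec_; _⊎-dec_)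
open import Relation.Nullary.Decidable using (⌊_⌋; decidable-stable)
open import Relation.Unary using (Pred; Decidable)

open Equivalence using (to; from)

sum-map≥length : ∀ {X : Set} (g : X → ℕ) {xs : List X} →
  (∀ {x} → x ∈ₗ xs → 1 ≤ g x) → length xs ≤ sum (map g xs)
sum-map≥length g {[]}     _        = z≤n
sum-map≥length g {x ∷ xs} positive =
  +-mono-≤ (positive (here refl)) (sum-map≥length g (positive ∘ there))

sum-map≡length⇔all-one : ∀ {X : Set} (g : X → ℕ) {xs : List X} →
  (∀ {x} → x ∈ₗ xs → 1 ≤ g x) →
  (sum (map g xs) ≡ length xs ⇔ (∀ {x} → x ∈ₗ xs → g x ≡ 1))
sum-map≡length⇔all-one g positive = mk⇔ (tight positive) ones
  where
  ones : ∀ {xs} → (∀ {x} → x ∈ₗ xs → g x ≡ 1) → sum (map g xs) ≡ length xs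
  ones {[]}     _    = refl
  ones {x ∷ xs} one = cong₂ _+_ (one (here refl)) (ones (one ∘ there))

  tight : ∀ {xs} → (∀ {x} → x ∈ₗ xs → 1 ≤ g x) →
          sum (map g xs) ≡ length xs → ∀ {x} → x ∈ₗ xs → g x ≡ 1
  tight {x ∷ xs} pos eq = λ { (here refl) → head-one ; (there x∈) → tight (pos ∘ there) rest x∈ }
    where
    open Data.Nat.Properties.≤-Reasoning
    head-one : g x ≡ 1
    head-one = ≤-antisym (+-cancelʳ-≤ (sum (map g xs)) (g x) 1 (begin
        g x + sum (map g xs)  ≡⟨ eq ⟩
        1 + length xs         ≤⟨ +-monoʳ-≤ 1 (sum-map≥length g (pos ∘ there)) ⟩
        1 + sum (map g xs)    ∎))
      (pos (here refl))
    rest : sum (map g xs) ≡ length xs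
    rest = +-cancelˡ-≡ 1 _ _ (trans (cong (_+ sum (map g xs)) (sym head-one)) eq)

length-filter-split : ∀ {X : Set} {p q : Pred X 0ℓ} (p? : Decidable p) (q? : Decidable q)
  (xs : List X) →
  length (filter p? xs) ≡
    length (filter (λ x → p? x ×-dec q? x) xs) + length (filter (λ x → p? x ×-dec ¬? (q? x)) xs)
length-filter-split p? q? [] = refl
length-filter-split p? q? (x ∷ xs) with p? x | q? x
... | yes _ | yes _ = cong suc (length-filter-split p? q? xs)
... | yes _ | no  _ = trans (cong suc (length-filter-split p? q? xs)) (sym (+-suc _ _))
... | no  _ | _     = length-filter-split p? q? xs

module Fibres {A B : Set} (_≟_ : DecidableEquality B) (f : A → B) where

  fibre : List A → B → List A
  fibre L b = filter (λ a → f a ≟ b) L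

  fibreSizes : List A → List B → List ℕ
  fibreSizes L Bs = map (length ∘ fibre L) Bs

  fibre-∷ : ∀ a L b → length (fibre (a ∷ L) b) ≡ length (fibre [ a ] b) + length (fibre L b)
  fibre-∷ a L b with f a ≟ b
  ... | yes _ = refl
  ... | no  _ = refl

  sum-fibreSizes-[] : ∀ Bs → sum (fibreSizes [] Bs) ≡ 0
  sum-fibreSizes-[] []       = refl
  sum-fibreSizes-[] (_ ∷ Bs) = sum-fibreSizes-[] Bs

  sum-fibreSizes-∷ : ∀ a L Bs →
    sum (fibreSizes (a ∷ L) Bs) ≡ sum (fibreSizes [ a ] Bs) + sum (fibreSizes L Bs)
  sum-fibreSizes-∷ a L []       = refl
  sum-fibreSizes-∷ a L (b ∷ Bs) =
    trans (cong₂ _+_ (fibre-∷ a L b) (sum-fibreSizes-∷ a L Bs))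
          (interchange (length (fibre [ a ] b)) _ _ _)

  singleton-fibres-absent : ∀ a {Bs} → f a ∉ₗ Bs → sum (fibreSizes [ a ] Bs) ≡ 0
  singleton-fibres-absent a {[]}     _   = refl
  singleton-fibres-absent a {b ∷ Bs} fa∉ with f a ≟ b
  ... | yes fa≡b = ⊥-elim (fa∉ (here fa≡b))
  ... | no  _    = singleton-fibres-absent a (fa∉ ∘ there)

  singleton-fibres : ∀ a {Bs} → Unique Bs → f a ∈ₗ Bs → sum (fibreSizes [ a ] Bs) ≡ 1
  singleton-fibres a {b ∷ Bs} (b∉Bs ∷ _) (here fa≡b) with f a ≟ b
  ... | yes _    = cong suc (singleton-fibres-absent a (λ fa∈ → All.lookup b∉Bs fa∈ (sym fa≡b)))
  ... | no fa≢b = ⊥-elim (fa≢b fa≡b)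
  singleton-fibres a {b ∷ Bs} (b∉Bs ∷ unique) (there fa∈) with f a ≟ b
  ... | yes fa≡b = ⊥-elim (All.lookup b∉Bs fa∈ (sym fa≡b))
  ... | no  _    = singleton-fibres a unique fa∈

  length≡sum-fibreSizes : ∀ L {Bs} → Unique Bs → (∀ {a} → a ∈ₗ L → f a ∈ₗ Bs) →
    length L ≡ sum (fibreSizes L Bs)
  length≡sum-fibreSizes []      {Bs} _      _    = sym (sum-fibreSizes-[] Bs)
  length≡sum-fibreSizes (a ∷ L) {Bs} unique into = begin
    1 + length L                                       ≡⟨ cong₂ _+_
                                                            (sym (singleton-fibres a unique (into (here refl))))
                                                            (length≡sum-fibreSizes L unique (into ∘ there)) ⟩
    sum (fibreSizes [ a ] Bs) + sum (fibreSizes L Bs)  ≡⟨ sym (sum-fibreSizes-∷ a L Bs) ⟩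
    sum (fibreSizes (a ∷ L) Bs)                        ∎
    where open ≡-Reasoning

occurs-once : ∀ {X : Set} (_≟_ : DecidableEquality X) {xs : List X} {y} →
  Unique xs → y ∈ₗ xs → length (filter (_≟ y) xs) ≡ 1
occurs-once _≟_ {x ∷ xs} (x∉xs ∷ _) (here refl) =
  trans (cong length (filter-accept (_≟ x) refl))
        (cong (suc ∘ length) (filter-none (_≟ x) (All.map (λ x≢a a≡x → x≢a (sym a≡x)) x∉xs)))
occurs-once _≟_ {x ∷ xs} {y} (x∉xs ∷ unique) (there y∈xs) =
  trans (cong length (filter-reject (_≟ y) (All.lookup x∉xs y∈xs)))
        (occurs-once _≟_ unique y∈xs)

-- Duplicate-free lists with the same members have the same length
-- (count xs along the fibres of the identity over ys).
same-members⇒length≡ : ∀ {X : Set} → DecidableEquality X → ∀ {xs ys : List X} →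
  Unique xs → Unique ys → (∀ {a} → a ∈ₗ xs → a ∈ₗ ys) → (∀ {a} → a ∈ₗ ys → a ∈ₗ xs) →
  length xs ≡ length ys
same-members⇒length≡ _≟_ {xs} {ys} xs-unique ys-unique xs⊆ys ys⊆xs =
  trans (length≡sum-fibreSizes xs ys-unique xs⊆ys)
        (from (sum-map≡length⇔all-one (length ∘ fibre xs) (≤-reflexive ∘ sym ∘ once)) once)
  where
  open Fibres _≟_ (λ a → a)
  once : ∀ {y} → y ∈ₗ ys → length (fibre xs y) ≡ 1
  once y∈ys = occurs-once _≟_ xs-unique (ys⊆xs y∈ys)

length≡1⇒members-equal : ∀ {X : Set} {xs : List X} {x y} →
  length xs ≡ 1 → x ∈ₗ xs → y ∈ₗ xs → x ≡ y
length≡1⇒members-equal {xs = _ ∷ []} _ (here refl) (here refl) = refl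

members-equal⇒length≤1 : ∀ {X : Set} {xs : List X} →
  Unique xs → (∀ {x y} → x ∈ₗ xs → y ∈ₗ xs → x ≡ y) → length xs ≤ 1
members-equal⇒length≤1 {xs = []}         _ _ = z≤n
members-equal⇒length≤1 {xs = _ ∷ []}     _ _ = s≤s z≤n
members-equal⇒length≤1 {xs = _ ∷ _ ∷ _} ((x≢y ∷ _) ∷ _) equal =
  ⊥-elim (x≢y (equal (here refl) (there (here refl))))

∈-allSubsets : ∀ {n} (p : Subset n) → p ∈ₗ allSubsets n
∈-allSubsets {zero}  []          = here refl
∈-allSubsets {suc n} (true ∷ p)  = ∈-++⁺ˡ (∈-map⁺ (true ∷_) (∈-allSubsets p))
∈-allSubsets {suc n} (false ∷ p) =
  ∈-++⁺ʳ (map (true ∷_) (allSubsets n)) (∈-map⁺ (false ∷_) (∈-allSubsets p))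

allSubsets-unique : ∀ n → Unique (allSubsets n)
allSubsets-unique zero    = [] ∷ []
allSubsets-unique (suc n) =
  Unique.++⁺ (Unique.map⁺ tail-injective (allSubsets-unique n))
             (Unique.map⁺ tail-injective (allSubsets-unique n)) heads-differ
  where
  tail-injective : ∀ {b} {p q : Subset n} → b ∷ p ≡ b ∷ q → p ≡ q
  tail-injective refl = refl
  heads-differ : ∀ {v} → ¬ (v ∈ₗ map (true ∷_) (allSubsets n) ×
                            v ∈ₗ map (false ∷_) (allSubsets n))
  heads-differ (v∈₁ , v∈₂) with ∈-map⁻ (true ∷_) v∈₁ | ∈-map⁻ (false ∷_) v∈₂
  ... | _ , _ , refl | _ , _ , ()

∈-filter-allSubsets⇔ : ∀ {n} {q : Pred (Subset n) 0ℓ} (q? : Decidable q) {p} →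
  p ∈ₗ filter q? (allSubsets n) ⇔ q p
∈-filter-allSubsets⇔ {n} q? {p} = mk⇔ (proj₂ ∘ ∈-filter⁻ q? {xs = allSubsets n}) (∈-filter⁺ q? (∈-allSubsets p))

module _ {X : Set} where

  unorderedPairs⁻ : ∀ {xs : List X} {a b} → (a , b) ∈ₗ unorderedPairs xs → a ∈ₗ xs × b ∈ₗ xs
  unorderedPairs⁻ {x ∷ xs} ab∈ with ∈-++⁻ (map (x ,_) xs) ab∈
  ... | inj₁ ab∈head with ∈-map⁻ (x ,_) ab∈head
  ...   | _ , b∈ , refl = here refl , there b∈
  unorderedPairs⁻ {x ∷ xs} ab∈ | inj₂ ab∈tail with unorderedPairs⁻ ab∈tail
  ... | a∈ , b∈ = there a∈ , there b∈

  unorderedPairs⁺ : ∀ {xs : List X} {a b} → a ∈ₗ xs → b ∈ₗ xs → a ≢ b →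
    (a , b) ∈ₗ unorderedPairs xs ⊎ (b , a) ∈ₗ unorderedPairs xs
  unorderedPairs⁺ {x ∷ xs} (here refl) (here refl) a≢b = ⊥-elim (a≢b refl)
  unorderedPairs⁺ {x ∷ xs} (here refl) (there b∈)  _  = inj₁ (∈-++⁺ˡ (∈-map⁺ (x ,_) b∈))
  unorderedPairs⁺ {x ∷ xs} (there a∈)  (here refl) _  = inj₂ (∈-++⁺ˡ (∈-map⁺ (x ,_) a∈))
  unorderedPairs⁺ {x ∷ xs} (there a∈)  (there b∈)  a≢b =
    Data.Sum.map (∈-++⁺ʳ (map (x ,_) xs)) (∈-++⁺ʳ (map (x ,_) xs)) (unorderedPairs⁺ a∈ b∈ a≢b)

  unorderedPairs-unique : ∀ {xs : List X} → Unique xs → Unique (unorderedPairs xs)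
  unorderedPairs-unique {[]}     _               = []
  unorderedPairs-unique {x ∷ xs} (x∉xs ∷ unique) =
    Unique.++⁺ (Unique.map⁺ second-injective unique) (unorderedPairs-unique unique) first-differs
    where
    second-injective : ∀ {b c} → (x , b) ≡ (x , c) → b ≡ c
    second-injective refl = refl
    first-differs : ∀ {v} → ¬ (v ∈ₗ map (x ,_) xs × v ∈ₗ unorderedPairs xs)
    first-differs (v∈head , v∈tail) with ∈-map⁻ (x ,_) v∈head
    ... | _ , _ , refl = All.lookup x∉xs (proj₁ (unorderedPairs⁻ v∈tail)) refl

  unorderedPairs-oneOrder : ∀ {xs : List X} → Unique xs → ∀ {a b} →
    (a , b) ∈ₗ unorderedPairs xs → (b , a) ∈ₗ unorderedPairs xs → ⊥
  unorderedPairs-oneOrder {x ∷ xs} (x∉xs ∷ unique) ab∈ ba∈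
    with ∈-++⁻ (map (x ,_) xs) ab∈ | ∈-++⁻ (map (x ,_) xs) ba∈
  ... | inj₁ ab∈head | inj₁ ba∈head with ∈-map⁻ (x ,_) ab∈head | ∈-map⁻ (x ,_) ba∈head
  ...   | _ , x∈xs , refl | _ , _ , refl = All.lookup x∉xs x∈xs refl
  unorderedPairs-oneOrder {x ∷ xs} (x∉xs ∷ _) _ _ | inj₁ ab∈head | inj₂ ba∈tail
    with ∈-map⁻ (x ,_) ab∈head
  ... | _ , _ , refl = All.lookup x∉xs (proj₂ (unorderedPairs⁻ ba∈tail)) refl
  unorderedPairs-oneOrder {x ∷ xs} (x∉xs ∷ _) _ _ | inj₂ ab∈tail | inj₁ ba∈head
    with ∈-map⁻ (x ,_) ba∈head
  ... | _ , _ , refl = All.lookup x∉xs (proj₂ (unorderedPairs⁻ ab∈tail)) refl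
  unorderedPairs-oneOrder {x ∷ xs} (_ ∷ unique) _ _ | inj₂ ab∈tail | inj₂ ba∈tail =
    unorderedPairs-oneOrder unique ab∈tail ba∈tail

⌊⌋≡true⇔ : ∀ {X : Set} (x? : Dec X) → ⌊ x? ⌋ ≡ true ⇔ X
⌊⌋≡true⇔ (yes x) = mk⇔ (λ _ → x) (λ _ → refl)
⌊⌋≡true⇔ (no ¬x) = mk⇔ (λ ()) (λ x → ⊥-elim (¬x x))

⌊⌋-∨-∧ : ∀ {X Y Z : Set} (x? : Dec X) (y? : Dec Y) (z? : Dec Z) →
  ⌊ x? ⌋ ∨ (⌊ y? ⌋ ∧ ⌊ z? ⌋) ≡ ⌊ x? ⊎-dec (y? ×-dec z?) ⌋
⌊⌋-∨-∧ (yes _) _       _       = refl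
⌊⌋-∨-∧ (no _)  (yes _) (yes _) = refl
⌊⌋-∨-∧ (no _)  (yes _) (no _)  = refl
⌊⌋-∨-∧ (no _)  (no _)  _       = refl

∈-tabulate⇔ : ∀ {n} {q : Pred (Fin n) 0ℓ} (g : Fin n → Bool) (q? : Decidable q) →
  (∀ y → g y ≡ ⌊ q? y ⌋) → ∀ {y} → y ∈ tabulate g ⇔ q y
∈-tabulate⇔ g q? g≡ {y} = ⇔-trans ∈⇔g≡true (⇔-trans g≡true⇔ (⌊⌋≡true⇔ (q? y)))
  where
  ∈⇔g≡true : y ∈ tabulate g ⇔ g y ≡ true
  ∈⇔g≡true = mk⇔ (λ y∈ → trans (sym (lookup∘tabulate g y)) ([]=⇒lookup y∈))
                 (λ gy → lookup⇒[]= y (tabulate g) (trans (lookup∘tabulate g y) gy))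
  g≡true⇔ : g y ≡ true ⇔ ⌊ q? y ⌋ ≡ true
  g≡true⇔ = mk⇔ (trans (sym (g≡ y))) (trans (g≡ y))

⊆∧≢⇒⊂ : ∀ {n} {p q : Subset n} → p ⊆ q → p ≢ q → p ⊂ q
⊆∧≢⇒⊂ {p = p} {q} p⊆q p≢q with any? (λ x → (x ∈? q) ×-dec ¬? (x ∈? p))
... | yes new  = p⊆q , new
... | no  none = ⊥-elim (p≢q (⊆-antisym p⊆q q⊆p))
  where
  q⊆p : q ⊆ p
  q⊆p {x} x∈q = decidable-stable (x ∈? p) (λ x∉p → none (x , x∈q , x∉p))

module Connectivity {n : ℕ} (P : FinPoset n) where

  EdgeClosed : Subset n → Subset n → Set
  EdgeClosed J S = ∀ {z y} → z ∈ S → y ∈ J → HasseEdge P z y → y ∈ S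

  -- J is connected iff every edge-closed set meeting J contains all of J;
  -- this closure form is the one the proofs below work with
  Connected : Subset n → Set
  Connected J = ∀ {x} → x ∈ J → ∀ S → x ∈ S → EdgeClosed J S → J ⊆ S

  EdgeClosed-⊆ : ∀ {J K S} → J ⊆ K → EdgeClosed K S → EdgeClosed J S
  EdgeClosed-⊆ J⊆K closed z∈S y∈J = closed z∈S (J⊆K y∈J)

  -- one round of the search defining reach: add the vertices of J adjacent to R;
  -- by definition reach P J (suc k) x = search-step J (reach P J k x)
  search-step : Subset n → Subset n → Subset n
  search-step J R = tabulate λ y →
    ⌊ y ∈? R ⌋ ∨ (⌊ y ∈? J ⌋ ∧ ⌊ any? (λ z → (z ∈? R) ×-dec HasseEdge? P z y) ⌋)

  ∈-search-step⇔ : ∀ {J R y} →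
    y ∈ search-step J R ⇔ (y ∈ R ⊎ (y ∈ J × ∃ λ z → z ∈ R × HasseEdge P z y))
  ∈-search-step⇔ {J} {R} = ∈-tabulate⇔ _
    (λ y → (y ∈? R) ⊎-dec ((y ∈? J) ×-dec any? (λ z → (z ∈? R) ×-dec HasseEdge? P z y)))
    (λ y → ⌊⌋-∨-∧ (y ∈? R) (y ∈? J) (any? (λ z → (z ∈? R) ×-dec HasseEdge? P z y)))

  start∈reach : ∀ J x k → x ∈ reach P J k x
  start∈reach J x zero    = x∈⁅x⁆ x
  start∈reach J x (suc k) = from ∈-search-step⇔ (inj₁ (start∈reach J x k))

  reach-⊆-suc : ∀ J x k → reach P J k x ⊆ reach P J (suc k) x
  reach-⊆-suc J x k y∈ = from ∈-search-step⇔ (inj₁ y∈)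

  reach⊆closed : ∀ {J S x} → x ∈ S → EdgeClosed J S → ∀ k → reach P J k x ⊆ S
  reach⊆closed {x = x} x∈S closed zero {y} y∈ = subst (_∈ _) (sym (x∈⁅y⁆⇒x≡y x y∈)) x∈S
  reach⊆closed x∈S closed (suc k) y∈ with to ∈-search-step⇔ y∈
  ... | inj₁ y∈R                  = reach⊆closed x∈S closed k y∈R
  ... | inj₂ (y∈J , z , z∈R , zy) = closed (reach⊆closed x∈S closed k z∈R) y∈J zy

  reach-stalls : ∀ J x j → reach P J j x ≡ reach P J (suc j) x →
    ∀ m → reach P J (m + j) x ≡ reach P J j x
  reach-stalls J x j stall zero    = refl
  reach-stalls J x j stall (suc m) = trans (cong (search-step J) (reach-stalls J x j stall m)) (sym stall)

  stalled-or-large : ∀ J x k →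
    (∃ λ j → j ≤ k × reach P J j x ≡ reach P J (suc j) x) ⊎ k < ∣ reach P J k x ∣
  stalled-or-large J x zero = inj₂ (≤-reflexive (sym (∣⁅x⁆∣≡1 x)))
  stalled-or-large J x (suc k) with stalled-or-large J x k
  ... | inj₁ (j , j≤k , stall) = inj₁ (j , m≤n⇒m≤1+n j≤k , stall)
  ... | inj₂ k<∣R∣ with reach P J k x ≟S reach P J (suc k) x
  ...   | yes stall = inj₁ (k , n≤1+n k , stall)
  ...   | no  grows = inj₂ (≤-trans (s≤s k<∣R∣) (p⊂q⇒∣p∣<∣q∣ (⊆∧≢⇒⊂ (reach-⊆-suc J x k) grows)))

  -- as a subset of Fin n cannot have more than n elements, n rounds suffice
  reach-stable : ∀ J x → reach P J (suc n) x ≡ reach P J n x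
  reach-stable J x with stalled-or-large J x n
  ... | inj₂ n<∣R∣ = ⊥-elim (<⇒≱ n<∣R∣ (∣p∣≤n (reach P J n x)))
  ... | inj₁ (j , j≤n , stall) = begin
    reach P J (suc n) x            ≡⟨ cong (λ k → reach P J (suc k) x) (sym n∸j+j≡n) ⟩
    reach P J (suc (n ∸ j) + j) x  ≡⟨ reach-stalls J x j stall (suc (n ∸ j)) ⟩
    reach P J j x                  ≡⟨ sym (reach-stalls J x j stall (n ∸ j)) ⟩
    reach P J (n ∸ j + j) x        ≡⟨ cong (λ k → reach P J k x) n∸j+j≡n ⟩
    reach P J n x                  ∎
    where
    open ≡-Reasoning
    n∸j+j≡n : n ∸ j + j ≡ n
    n∸j+j≡n = m∸n+n≡m j≤n

  reach-closed : ∀ J x → EdgeClosed J (reach P J n x)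
  reach-closed J x z∈ y∈J zy =
    subst (_ ∈_) (reach-stable J x) (from ∈-search-step⇔ (inj₂ (y∈J , _ , z∈ , zy)))

  IsConnectedSet⇔Connected : ∀ J → IsConnectedSet P J ⇔ Connected J
  IsConnectedSet⇔Connected J = mk⇔ walks⇒closure closure⇒walks
    where
    walks⇒closure : IsConnectedSet P J → Connected J
    walks⇒closure walks x∈J S x∈S closed y∈J = reach⊆closed x∈S closed n (walks _ _ x∈J y∈J)
    closure⇒walks : Connected J → IsConnectedSet P J
    closure⇒walks connected x y x∈J y∈J =
      connected x∈J (reach P J n x) (start∈reach J x n) (reach-closed J x) y∈J

module Ideals {n : ℕ} (P : FinPoset n) where
  open FinPoset P
  open IsDecPartialOrder isDecPartialOrder
    using (isPartialOrder) renaming (refl to ≤P-refl; trans to ≤P-trans; antisym to ≤P-antisym)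
  open Connectivity P

  <P-wellFounded : WellFounded (_<P_ P)
  <P-wellFounded = po-wellFounded isPartialOrder

  >P-wellFounded : WellFounded (flip (_<P_ P))
  >P-wellFounded = po-noetherian isPartialOrder

  cover-below : ∀ {y w} → Acc (_<P_ P) w → _<P_ P y w → ∃ λ z → _⋖_ P y z × z ≤P w
  cover-below {y} {w} (acc below) y<w with any? (λ z → (_<P?_ P y z) ×-dec (_<P?_ P z w))
  ... | no nothing-between = w , (y<w , nothing-between) , ≤P-refl
  ... | yes (z , y<z , z<w) with cover-below (below z<w) y<z
  ...   | c , y⋖c , c≤z = c , y⋖c , ≤P-trans c≤z (proj₁ z<w)

  principal : Fin n → Subset n
  principal = ↓_ P

  ∈principal⇔ : ∀ {m y} → y ∈ principal m ⇔ y ≤P m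
  ∈principal⇔ {m} = ∈-tabulate⇔ _ (λ y → y ≤P? m) (λ _ → refl)

  m∈principal : ∀ m → m ∈ principal m
  m∈principal m = from ∈principal⇔ ≤P-refl

  principal-isOrderIdeal : ∀ m → IsOrderIdeal P (principal m)
  principal-isOrderIdeal m x y x∈ y≤x = from ∈principal⇔ (≤P-trans y≤x (to ∈principal⇔ x∈))

  principal-⊆ : ∀ {J m} → IsOrderIdeal P J → m ∈ J → principal m ⊆ J
  principal-⊆ J-ideal m∈J y∈ = J-ideal _ _ m∈J (to ∈principal⇔ y∈)

  principal-injective : ∀ {x y} → principal x ≡ principal y → x ≡ y
  principal-injective {x} {y} ↓x≡↓y = ≤P-antisym
    (to ∈principal⇔ (subst (x ∈_) ↓x≡↓y (m∈principal x)))
    (to ∈principal⇔ (subst (y ∈_) (sym ↓x≡↓y) (m∈principal y)))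

  -- in ↓m, an edge-closed set contains a point y iff it contains the top m:
  -- walk from y up to m along a chain of covers (induction on y from above)
  linked-to-top : ∀ {m S} → EdgeClosed (principal m) S →
    ∀ {y} → Acc (flip (_<P_ P)) y → y ≤P m → (y ∈ S ⇔ m ∈ S)
  linked-to-top {m} closed {y} (acc above) y≤m with y Fin.≟ m
  ... | yes refl = ⇔-refl
  ... | no  y≢m with cover-below (<P-wellFounded m) (y≤m , y≢m)
  ...   | z , y⋖z , z≤m = ⇔-trans (mk⇔ (λ y∈S → closed y∈S z∈↓m (inj₁ y⋖z))
                                       (λ z∈S → closed z∈S y∈↓m (inj₂ y⋖z)))
                                   (linked-to-top closed (above (proj₁ y⋖z)) z≤m)
    where
    z∈↓m = from ∈principal⇔ z≤m
    y∈↓m = from ∈principal⇔ y≤m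

  principal-connected : ∀ m → Connected (principal m)
  principal-connected m {x} x∈↓m S x∈S closed {y} y∈↓m =
    from (linked y y∈↓m) (to (linked x x∈↓m) x∈S)
    where
    linked : ∀ v → v ∈ principal m → v ∈ S ⇔ m ∈ S
    linked v v∈↓m = linked-to-top closed (>P-wellFounded v) (to ∈principal⇔ v∈↓m)

  principal-isConnIdeal : ∀ m → IsConnIdeal P (principal m)
  principal-isConnIdeal m =
    (m , m∈principal m) , principal-isOrderIdeal m ,
    from (IsConnectedSet⇔Connected _) (principal-connected m)

  ∪-isOrderIdeal : ∀ {A B} → IsOrderIdeal P A → IsOrderIdeal P B → IsOrderIdeal P (A ∪ B)
  ∪-isOrderIdeal {A} {B} A-ideal B-ideal x y x∈A∪B y≤x with x∈p∪q⁻ A B x∈A∪B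
  ... | inj₁ x∈A = p⊆p∪q B (A-ideal x y x∈A y≤x)
  ... | inj₂ x∈B = q⊆p∪q A B (B-ideal x y x∈B y≤x)

  -- two connected sets that meet have a connected union: an edge-closed set
  -- containing one of them contains the meeting point, hence the other one
  ∪-connected : ∀ {A B} → Connected A → Connected B → Nonempty (A ∩ B) → Connected (A ∪ B)
  ∪-connected {A} {B} A-conn B-conn (w , w∈A∩B) x∈A∪B S x∈S closed y∈A∪B =
    Data.Sum.[ proj₁ both , proj₂ both ] (x∈p∪q⁻ A B y∈A∪B)
    where
    closedA : EdgeClosed A S
    closedA = EdgeClosed-⊆ (p⊆p∪q B) closed
    closedB : EdgeClosed B S
    closedB = EdgeClosed-⊆ (q⊆p∪q A B) closed
    w∈A = proj₁ (x∈p∩q⁻ A B w∈A∩B)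
    w∈B = proj₂ (x∈p∩q⁻ A B w∈A∩B)
    both : A ⊆ S × B ⊆ S
    both with x∈p∪q⁻ A B x∈A∪B
    ... | inj₁ x∈A = let A⊆S = A-conn x∈A S x∈S closedA in A⊆S , B-conn w∈B S (A⊆S w∈A) closedB
    ... | inj₂ x∈B = let B⊆S = B-conn x∈B S x∈S closedB in A-conn w∈A S (B⊆S w∈B) closedA , B⊆S

  ∪-isConnIdeal : ∀ {A B} → IsConnIdeal P A → IsConnIdeal P B → Nonempty (A ∩ B) →
    IsConnIdeal P (A ∪ B)
  ∪-isConnIdeal {A} {B} ((a , a∈A) , A-ideal , A-conn) (_ , B-ideal , B-conn) meet =
    (a , p⊆p∪q B a∈A) , ∪-isOrderIdeal A-ideal B-ideal ,
    from (IsConnectedSet⇔Connected _)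
         (∪-connected (to (IsConnectedSet⇔Connected A) A-conn)
                      (to (IsConnectedSet⇔Connected B) B-conn) meet)

module Projection {n : ℕ} (P : FinPoset n) where
  open Connectivity P
  open Ideals P

  -- if A ∪ B = ↓x for ideals A, B then x lies in one of them, which then
  -- contains the other
  principal-union : ∀ {A B x} → IsOrderIdeal P A → IsOrderIdeal P B →
    A ∪ B ≡ principal x → B ⊆ A ⊎ A ⊆ B
  principal-union {A} {B} {x} A-ideal B-ideal A∪B≡↓x
    with x∈p∪q⁻ A B (subst (x ∈_) (sym A∪B≡↓x) (m∈principal x))
  ... | inj₁ x∈A = inj₁ (λ y∈B → principal-⊆ A-ideal x∈A (subst (_ ∈_) A∪B≡↓x (q⊆p∪q A B y∈B)))
  ... | inj₂ x∈B = inj₂ (λ y∈A → principal-⊆ B-ideal x∈B (subst (_ ∈_) A∪B≡↓x (p⊆p∪q B y∈A)))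

  π-wellDefined : ∀ {J₁ J₂} → InΠ P J₁ J₂ → IsB P (J₁ ∪ J₂)
  π-wellDefined (J₁-conn , J₂-conn , meet , J₁⊈J₂ , J₂⊈J₁) =
    ∪-isConnIdeal J₁-conn J₂-conn meet ,
    λ (x , J₁∪J₂≡↓x) → Data.Sum.[ J₂⊈J₁ , J₁⊈J₂ ]
      (principal-union (proj₁ (proj₂ J₁-conn)) (proj₁ (proj₂ J₂-conn)) J₁∪J₂≡↓x)

  -- Surjectivity: a connected nonprincipal ideal J is exhausted from inside
  -- by connected ideals K, each step adding a principal ideal that meets K.
  module Exhaustion {J} (J-ideal : IsOrderIdeal P J) (J-connected : Connected J)
                    (J-nonprincipal : ¬ IsPrincipal P J) where

    -- a nonempty ideal K ⊂ J has a point m ∈ J ∖ K with ↓m meeting K;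
    -- otherwise K would be edge-closed in J, hence all of J
    frontier : ∀ {K} → Nonempty K → IsOrderIdeal P K → K ⊂ J →
      ∃ λ m → m ∈ J × m ∉ K × Nonempty (K ∩ principal m)
    frontier {K} (x , x∈K) K-ideal (K⊆J , out , out∈J , out∉K)
      with any? (λ m → (m ∈? J) ×-dec (¬? (m ∈? K) ×-dec nonempty? (K ∩ principal m)))
    ... | yes found = found
    ... | no  none  = ⊥-elim (out∉K (J-connected (K⊆J x∈K) K x∈K closed out∈J))
      where
      closed : EdgeClosed J K
      closed z∈K y∈J (inj₂ y⋖z) = K-ideal _ _ z∈K (proj₁ (proj₁ y⋖z))
      closed {z} {y} z∈K y∈J (inj₁ z⋖y) = decidable-stable (y ∈? K) λ y∉K →
        none (y , y∈J , y∉K , z , x∈p∩q⁺ (z∈K , from ∈principal⇔ (proj₁ (proj₁ z⋖y))))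

    -- add frontier principal ideals to K until the union is J; the last
    -- added ↓m and the ideal K before it form a crossing pair
    exhaust : ∀ {K} → Acc _⊃_ K → IsConnIdeal P K → K ⊂ J →
      ∃ λ J₁ → ∃ λ J₂ → InΠ P J₁ J₂ × J₁ ∪ J₂ ≡ J
    exhaust {K} (acc larger) K-conn K⊂J
      with frontier (proj₁ K-conn) (proj₁ (proj₂ K-conn)) K⊂J
    ... | m , m∈J , m∉K , meet with (K ∪ principal m) ≟S J
    ...   | yes K∪↓m≡J = K , principal m , (K-conn , principal-isConnIdeal m , crossing) , K∪↓m≡J
      where
      J≡↓m : K ⊆ principal m → J ≡ principal m
      J≡↓m K⊆↓m = ⊆-antisym
        (λ y∈J → Data.Sum.[ K⊆↓m , (λ y∈↓m → y∈↓m) ] (x∈p∪q⁻ K _ (subst (_ ∈_) (sym K∪↓m≡J) y∈J)))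
        (principal-⊆ J-ideal m∈J)
      crossing : Crossing P K (principal m)
      crossing = meet , (λ K⊆↓m → J-nonprincipal (m , J≡↓m K⊆↓m)) , (λ ↓m⊆K → m∉K (↓m⊆K (m∈principal m)))
    ...   | no  K∪↓m≢J = exhaust (larger K⊂K∪↓m) (∪-isConnIdeal K-conn (principal-isConnIdeal m) meet)
                                 (⊆∧≢⇒⊂ K∪↓m⊆J K∪↓m≢J)
      where
      K⊂K∪↓m : K ⊂ K ∪ principal m
      K⊂K∪↓m = p⊆p∪q _ , m , q⊆p∪q K _ (m∈principal m) , m∉K
      K∪↓m⊆J : K ∪ principal m ⊆ J
      K∪↓m⊆J y∈ = Data.Sum.[ proj₁ K⊂J , principal-⊆ J-ideal m∈J ] (x∈p∪q⁻ K _ y∈)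

  -- π is surjective: start the exhaustion from ↓x for any x ∈ J
  π-surjective : ∀ {J} → IsB P J → ∃ λ J₁ → ∃ λ J₂ → InΠ P J₁ J₂ × J₁ ∪ J₂ ≡ J
  π-surjective {J} (((x , x∈J) , J-ideal , J-conn) , J-nonprincipal) =
    Exhaustion.exhaust J-ideal (to (IsConnectedSet⇔Connected J) J-conn) J-nonprincipal
      (⊃-wellFounded _) (principal-isConnIdeal x)
      (⊆∧≢⇒⊂ (principal-⊆ J-ideal x∈J) (λ ↓x≡J → J-nonprincipal (x , sym ↓x≡J)))

module Counting {n : ℕ} (P : FinPoset n) where
  open Ideals P
  open Projection P

  π : Subset n × Subset n → Subset n
  π q = proj₁ q ∪ proj₂ q

  open Fibres _≟S_ π public

  crossing? : Decidable (λ (q : Subset n × Subset n) → Crossing P (proj₁ q) (proj₂ q))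
  crossing? q = Crossing? P (proj₁ q) (proj₂ q)

  Crossing-sym : ∀ {a b} → Crossing P a b → Crossing P b a
  Crossing-sym {a} {b} ((w , w∈a∩b) , a⊈b , b⊈a) =
    (w , x∈p∩q⁺ (proj₂ (x∈p∩q⁻ a b w∈a∩b) , proj₁ (x∈p∩q⁻ a b w∈a∩b))) , b⊈a , a⊈b

  Crossing⇒≢ : ∀ {a b} → Crossing P a b → a ≢ b
  Crossing⇒≢ (_ , a⊈b , _) refl = a⊈b (λ x∈ → x∈)

  ∈Jconn⇔ : ∀ {J} → J ∈ₗ Jconn P ⇔ IsConnIdeal P J
  ∈Jconn⇔ = ∈-filter-allSubsets⇔ (IsConnIdeal? P)

  ∈Bset⇔ : ∀ {J} → J ∈ₗ Bset P ⇔ IsB P J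
  ∈Bset⇔ = ∈-filter-allSubsets⇔ (IsB? P)

  Jconn-unique : Unique (Jconn P)
  Jconn-unique = Unique.filter⁺ (IsConnIdeal? P) (allSubsets-unique n)

  Bset-unique : Unique (Bset P)
  Bset-unique = Unique.filter⁺ (IsB? P) (allSubsets-unique n)

  Πlist-unique : Unique (Πlist P)
  Πlist-unique = Unique.filter⁺ crossing? (unorderedPairs-unique Jconn-unique)

  ∈Πlist⇒InΠ : ∀ {a b} → (a , b) ∈ₗ Πlist P → InΠ P a b
  ∈Πlist⇒InΠ ab∈ with ∈-filter⁻ crossing? {xs = unorderedPairs (Jconn P)} ab∈
  ... | ab∈pairs , crossing with unorderedPairs⁻ ab∈pairs
  ...   | a∈ , b∈ = to ∈Jconn⇔ a∈ , to ∈Jconn⇔ b∈ , crossing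

  listed-copy : ∀ {a b} → InΠ P a b →
    ∃ λ q → q ∈ₗ Πlist P × π q ≡ a ∪ b × (q ≡ (a , b) ⊎ q ≡ (b , a))
  listed-copy {a} {b} (a-conn , b-conn , crossing)
    with unorderedPairs⁺ (from ∈Jconn⇔ a-conn) (from ∈Jconn⇔ b-conn) (Crossing⇒≢ crossing)
  ... | inj₁ ab∈ = (a , b) , ∈-filter⁺ crossing? ab∈ crossing , refl , inj₁ refl
  ... | inj₂ ba∈ = (b , a) , ∈-filter⁺ crossing? ba∈ (Crossing-sym crossing) , ∪-comm b a , inj₂ refl

  Πlist-oneOrder : ∀ {a b} → (a , b) ∈ₗ Πlist P → (b , a) ∈ₗ Πlist P → ⊥
  Πlist-oneOrder ab∈ ba∈ = unorderedPairs-oneOrder Jconn-unique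
    (proj₁ (∈-filter⁻ crossing? {xs = unorderedPairs (Jconn P)} ab∈))
    (proj₁ (∈-filter⁻ crossing? {xs = unorderedPairs (Jconn P)} ba∈))

  -- the connected principal ideals are the ↓x, one for each of the n points
  principal-count : length (filter (λ J → IsConnIdeal? P J ×-dec IsPrincipal? P J) (allSubsets n)) ≡ n
  principal-count = begin
    length principals                ≡⟨ same-members⇒length≡ _≟S_
                                          (Unique.filter⁺ _ (allSubsets-unique n))
                                          (Unique.map⁺ principal-injective (Unique.allFin⁺ n))
                                          listed⇒image image⇒listed ⟩
    length (map principal (allFin n)) ≡⟨ length-map principal (allFin n) ⟩
    length (allFin n)                ≡⟨ length-tabulate (λ i → i) ⟩
    n                                ∎
    where
    open ≡-Reasoning
    principals = filter (λ J → IsConnIdeal? P J ×-dec IsPrincipal? P J) (allSubsets n)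
    listed⇒image : ∀ {J} → J ∈ₗ principals → J ∈ₗ map principal (allFin n)
    listed⇒image J∈ with to (∈-filter-allSubsets⇔ _) J∈
    ... | _ , x , refl = ∈-map⁺ principal (∈-allFin x)
    image⇒listed : ∀ {J} → J ∈ₗ map principal (allFin n) → J ∈ₗ principals
    image⇒listed J∈ with ∈-map⁻ principal J∈
    ... | x , _ , refl = from (∈-filter-allSubsets⇔ _) (principal-isConnIdeal x , x , refl)

  length-Jconn : length (Jconn P) ≡ n + length (Bset P)
  length-Jconn = trans (length-filter-split (IsConnIdeal? P) (IsPrincipal? P) (allSubsets n))
                       (cong (_+ length (Bset P)) principal-count)

  -- |Π| = Σ_{J ∈ 𝓑} |π⁻¹ J|, as π maps Π into 𝓑
  length-Πlist : length (Πlist P) ≡ sum (fibreSizes (Πlist P) (Bset P))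
  length-Πlist = length≡sum-fibreSizes (Πlist P) Bset-unique
    (λ q∈ → from ∈Bset⇔ (π-wellDefined (∈Πlist⇒InΠ q∈)))

  -- every fibre over 𝓑 is inhabited, as π is onto
  fibre-nonempty : ∀ {J} → J ∈ₗ Bset P → 1 ≤ length (fibre (Πlist P) J)
  fibre-nonempty {J} J∈ with π-surjective (to ∈Bset⇔ J∈)
  ... | _ , _ , inΠ , J₁∪J₂≡J with listed-copy inΠ
  ...   | _ , q∈ , πq≡J₁∪J₂ , _ = filter-some (λ q → π q ≟S J) (lose q∈ (trans πq≡J₁∪J₂ J₁∪J₂≡J))

module Conditions {n : ℕ} (P : FinPoset n) where
  open Projection P
  open Counting P

  FibresAreSingletons : Set
  FibresAreSingletons = ∀ {J} → J ∈ₗ Bset P → length (fibre (Πlist P) J) ≡ 1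

  Balanced : Set
  Balanced = length (Πlist P) ≡ length (Bset P)

  -- by |𝒥_conn| = n + |𝓑|, (i) and (ii) are both |Π| = |𝓑|
  I⇔balanced : CondI P ⇔ Balanced
  I⇔balanced = mk⇔ (λ I → +-cancelˡ-≡ n _ _ (trans I length-Jconn))
                   (λ balanced → trans (cong (n +_) balanced) (sym length-Jconn))

  balanced⇔II : Balanced ⇔ CondII P
  balanced⇔II = mk⇔ (λ balanced → balanced , sym (trans (cong (_∸ n) length-Jconn) (m+n∸m≡n n _)))
                    proj₁

  -- with all fibres inhabited, |Π| = Σ |π⁻¹ J| equals |𝓑| iff all are singletons
  balanced⇔singletons : Balanced ⇔ FibresAreSingletons
  balanced⇔singletons = ⇔-trans
    (mk⇔ (trans (sym length-Πlist)) (trans length-Πlist))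
    (sum-map≡length⇔all-one (length ∘ fibre (Πlist P)) fibre-nonempty)

  -- nearly principal means precisely a singleton fibre
  singletons⇔IV : FibresAreSingletons ⇔ CondIV P
  singletons⇔IV = mk⇔ singletons⇒IV IV⇒singletons
    where
    singletons⇒IV : FibresAreSingletons → CondIV P
    singletons⇒IV singletons J J-conn with IsPrincipal? P J
    ... | yes principal    = inj₁ principal
    ... | no  nonprincipal =
      inj₂ ((J-conn , nonprincipal) , singletons (from ∈Bset⇔ (J-conn , nonprincipal)))
    IV⇒singletons : CondIV P → FibresAreSingletons
    IV⇒singletons IV J∈ with to ∈Bset⇔ J∈
    ... | J-conn , nonprincipal with IV _ J-conn
    ...   | inj₁ principal              = ⊥-elim (nonprincipal principal)
    ...   | inj₂ (_ , singleton-fibre) = singleton-fibre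

  same-copy⇒SamePair : ∀ {a b c d q} →
    (q ≡ (a , b) ⊎ q ≡ (b , a)) → (q ≡ (c , d) ⊎ q ≡ (d , c)) → SamePair P (a , b) (c , d)
  same-copy⇒SamePair (inj₁ refl) (inj₁ refl) = inj₁ (refl , refl)
  same-copy⇒SamePair (inj₁ refl) (inj₂ refl) = inj₂ (refl , refl)
  same-copy⇒SamePair (inj₂ refl) (inj₁ refl) = inj₂ (refl , refl)
  same-copy⇒SamePair (inj₂ refl) (inj₂ refl) = inj₁ (refl , refl)

  -- π is a bijection iff its fibres are singletons (it is always well
  -- defined and onto)
  singletons⇔III : FibresAreSingletons ⇔ CondIII P
  singletons⇔III = mk⇔ singletons⇒III III⇒singletons
    where
    singletons⇒III : FibresAreSingletons → CondIII P
    singletons⇒III singletons = (λ _ _ → π-wellDefined) , injective , (λ _ → π-surjective)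
      where
      injective : ∀ J₁ J₂ J₁′ J₂′ → InΠ P J₁ J₂ → InΠ P J₁′ J₂′ →
        J₁ ∪ J₂ ≡ J₁′ ∪ J₂′ → SamePair P (J₁ , J₂) (J₁′ , J₂′)
      injective J₁ J₂ J₁′ J₂′ inΠ inΠ′ same-union
        with listed-copy inΠ | listed-copy inΠ′
      ... | q , q∈ , πq≡ , q-orient | q′ , q′∈ , πq′≡ , q′-orient =
        same-copy⇒SamePair q-orient (subst (λ r → r ≡ (J₁′ , J₂′) ⊎ r ≡ (J₂′ , J₁′)) (sym q≡q′) q′-orient)
        where
        U = J₁ ∪ J₂
        q≡q′ : q ≡ q′
        q≡q′ = length≡1⇒members-equal
          (singletons (from ∈Bset⇔ (π-wellDefined inΠ)))
          (∈-filter⁺ (λ r → π r ≟S U) q∈ πq≡)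
          (∈-filter⁺ (λ r → π r ≟S U) q′∈ (trans πq′≡ (sym same-union)))
    III⇒singletons : CondIII P → FibresAreSingletons
    III⇒singletons (_ , injective , _) {J} J∈ =
      ≤-antisym (members-equal⇒length≤1 (Unique.filter⁺ _ Πlist-unique) equal) (fibre-nonempty J∈)
      where
      equal : ∀ {q q′} → q ∈ₗ fibre (Πlist P) J → q′ ∈ₗ fibre (Πlist P) J → q ≡ q′
      equal {a , b} {c , d} q∈ q′∈
        with ∈-filter⁻ (λ r → π r ≟S J) {xs = Πlist P} q∈ | ∈-filter⁻ (λ r → π r ≟S J) {xs = Πlist P} q′∈
      ... | q∈Π , πq≡J | q′∈Π , πq′≡J
        with injective a b c d (∈Πlist⇒InΠ q∈Π) (∈Πlist⇒InΠ q′∈Π) (trans πq≡J (sym πq′≡J))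
      ...   | inj₁ (refl , refl) = refl
      ...   | inj₂ (refl , refl) = ⊥-elim (Πlist-oneOrder q∈Π q′∈Π)

proposition10p2 : (n : ℕ) (P : FinPoset n) →
    (CondI P ⇔ CondII P) × (CondI P ⇔ CondIII P) × (CondI P ⇔ CondIV P)
proposition10p2 n P =
    ⇔-trans I⇔balanced balanced⇔II
  , ⇔-trans I⇔singletons singletons⇔III
  , ⇔-trans I⇔singletons singletons⇔IV
  where
  open Conditions P
  I⇔singletons : CondI P ⇔ FibresAreSingletons
  I⇔singletons = ⇔-trans I⇔balanced balanced⇔singletons
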